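{- Let $n\geq 5$, $k\ge 4$, and let $\tau=\tau_1\cdots\tau_{k-2}21\in S_k$ be a pattern with $\tau_{k-1}=2$, $\tau_k=1$. Then $$\left|\mathcal{A}_n(\tau,4321;213)\big|_2^2\right|=a_{n-1}(\tau,4321;213).$$
   Context: A permutation $\pi$ of $[n]=\{1,\dots,n\}$ is cyclic if it consists of a single $n$-cycle. Its one-line notation is $\pi_1\pi_2\cdots\pi_n$ with $\pi_i=\pi(i)$. Its standard cycle form is $(c_1,c_2,\dots,c_n)$ with $c_1=1$ and $c_{i+1}=\pi(c_i)$ for $1\le i<n$. A sequence $w_1\cdots w_n$ of distinct integers contains a pattern $\sigma=\sigma_1\cdots\sigma_k\in S_k$ if there are indices $i_1<\dots<i_k$ with $w_{i_s}>w_{i_t}$ iff $\sigma_s>\sigma_t$ for all $s<t$; otherwise it avoids $\sigma$. $\mathcal{A}_n(\sigma_1,\dots,\sigma_l;\rho)$ is the set of cyclic permutations of $[n]$ whose one-line notation avoids each $\sigma_i$ and whose standard cycle form $c_1\cdots c_n$, read as a sequence, avoids $\rho$; $a_n(\sigma_1,\dots,\sigma_l;\rho)$ is its cardinality. $\mathcal{A}_n(\sigma_1,\dots,\sigma_l;\rho)\big|_2^2$ denotes the set of $\pi\in\mathcal{A}_n(\sigma_1,\dots,\sigma_l;\rho)$ whose standard cycle form has $c_2=2$. -}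

module Defs where

open import Data.Bool using (Bool; true; false; _∧_; not; if_then_else_)
open import Data.Nat using (ℕ; zero; suc; _<ᵇ_; _≡ᵇ_)
open import Data.List using (List; []; _∷_; map; concatMap; length; filterᵇ; zipWith)
open import Data.Bool.ListAction using (all; any; and)

-- Permutations of [n] = {1,…,n} are represented by their one-line notation
-- π₁π₂⋯πₙ, a list of natural numbers (values 1-based).

insertEverywhere : ℕ → List ℕ → List (List ℕ)
insertEverywhere x []       = (x ∷ []) ∷ []
insertEverywhere x (y ∷ ys) = (x ∷ y ∷ ys) ∷ map (y ∷_) (insertEverywhere x ys)

perms : ℕ → List (List ℕ)
perms zero    = [] ∷ []
perms (suc n) = concatMap (insertEverywhere (suc n)) (perms n)

-- π(i) for a permutation in one-line notation (1-based index; 0 if out of range)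
apply : List ℕ → ℕ → ℕ
apply []       _             = 0
apply (x ∷ xs) zero          = 0
apply (x ∷ xs) (suc zero)    = x
apply (x ∷ xs) (suc (suc i)) = apply xs (suc i)

orbitSeq : List ℕ → ℕ → ℕ → List ℕ
orbitSeq π zero    x = []
orbitSeq π (suc m) x = x ∷ orbitSeq π m (apply π x)

cycleForm : List ℕ → List ℕ
cycleForm π = orbitSeq π (length π) 1

distinct : List ℕ → Bool
distinct []       = true
distinct (x ∷ xs) = all (λ y → not (x ≡ᵇ y)) xs ∧ distinct xs

-- π (a permutation of [n]) is cyclic, i.e. a single n-cycle:
-- the orbit 1, π(1), …, π^{n-1}(1) consists of n distinct elements
isCyclic : List ℕ → Bool
isCyclic π = distinct (cycleForm π)

subseqs : ℕ → List ℕ → List (List ℕ)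
subseqs zero    _        = [] ∷ []
subseqs (suc k) []       = []
subseqs (suc k) (x ∷ xs) = map (x ∷_) (subseqs k xs) ++' subseqs (suc k) xs
  where
  _++'_ : List (List ℕ) → List (List ℕ) → List (List ℕ)
  []       ++' ys = ys
  (z ∷ zs) ++' ys = z ∷ (zs ++' ys)

orderIso : List ℕ → List ℕ → Bool
orderIso []       []       = true
orderIso (x ∷ xs) (y ∷ ys) =
  and (zipWith (λ a b → eqB (a <ᵇ x) (b <ᵇ y)) xs ys) ∧ orderIso xs ys
  where
  eqB : Bool → Bool → Bool
  eqB true  b = b
  eqB false b = not b
orderIso _        _        = false

contains : List ℕ → List ℕ → Bool
contains σ w = any (λ u → orderIso u σ) (subseqs (length σ) w)

avoids : List ℕ → List ℕ → Bool
avoids σ w = not (contains σ w)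

inA : List (List ℕ) → List ℕ → List ℕ → Bool
inA σs ρ π = isCyclic π ∧ all (λ σ → avoids σ π) σs ∧ avoids ρ (cycleForm π)

c₂≡2 : List ℕ → Bool
c₂≡2 π = apply (cycleForm π) 2 ≡ᵇ 2

𝒜 : ℕ → List (List ℕ) → List ℕ → List (List ℕ)
𝒜 n σs ρ = filterᵇ (inA σs ρ) (perms n)

a : ℕ → List (List ℕ) → List ℕ → ℕ
a n σs ρ = length (𝒜 n σs ρ)

𝒜₂² : ℕ → List (List ℕ) → List ℕ → List (List ℕ)
𝒜₂² n σs ρ = filterᵇ c₂≡2 (𝒜 n σs ρ)

{-# OPTIONS --safe #-}
module Submission where

-- A cyclic π with c₂ = 2 has π(1) = 2. Deleting this leading 2 from the one-line notation and
-- lowering the values above 2 by one gives a permutation π′ of [n−1], and π = cons2 π′. On cycle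
-- forms this merges 1 and 2: (1,2,c₃,…,cₙ) ↦ (1,c₃−1,…,cₙ−1), so π is cyclic iff π′ is. The
-- leading 1 and 2 of the cycle form of π are smaller than all later entries, so they cannot
-- start an occurrence of 213; and the leading 2 of π cannot start an occurrence of τ or 4321,
-- since both end in a descent 21 below their first entry while only the value 1 lies below 2.
-- Hence cons2 maps 𝒜_{n−1}(τ,4321;213) bijectively onto 𝒜_n(τ,4321;213)|₂².

open import Defs
open import Data.Bool using (Bool; true; false; _∧_; _∨_; not; if_then_else_)
open import Data.Bool.Properties using (∧-zeroʳ; ∧-conicalˡ; ∧-conicalʳ; ∨-assoc; ¬-not)
open import Data.Bool.ListAction using (all; any; and; or)
open import Data.Empty using (⊥; ⊥-elim)
open import Data.Nat using (ℕ; zero; suc; _+_; _≤_; _∸_; z≤n; s≤s; _<ᵇ_; _≡ᵇ_)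
open import Data.Nat.Properties using (_≟_; ≤-trans; <⇒≢; suc-injective)
import Data.List as List
open import Data.List
  using (List; []; _∷_; length; _++_; map; concatMap; filterᵇ; zipWith; applyDownFrom)
open import Data.List.Properties
  using ( map-++; map-∘; map-cong; map-cong-local; length-map; length-applyDownFrom
        ; zipWith-cong; filter-++; concatMap-map; map-concatMap; concatMap-cong)
open import Data.List.Membership.Propositional using (_∈_)
open import Data.List.Relation.Unary.Any using (here; there)
open import Data.List.Relation.Binary.Permutation.Propositional
  using (_↭_; ↭-refl; ↭-trans; ↭-prep; ↭-swap; ↭-sym; ↭⇒↭ₛ)
open import Data.List.Relation.Binary.Permutation.Propositional.Properties
  using (↭-length; All-resp-↭)
open import Data.List.Relation.Binary.Pointwise using (Pointwise; []; _∷_)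
open import Data.List.Relation.Unary.All using (All; []; _∷_)
import Data.List.Relation.Unary.All as All
import Data.List.Relation.Unary.All.Properties as Allₚ
open import Data.List.Relation.Unary.AllPairs using (AllPairs)
open import Data.List.Relation.Unary.Unique.Propositional using (Unique)
import Data.List.Relation.Unary.Unique.Propositional.Properties as Uniqueₚ
open import Data.Product using (Σ; _×_; _,_; proj₁; proj₂)
open import Data.Sum using (_⊎_; inj₁; inj₂)
open import Function using (_∘_)
open import Relation.Binary.PropositionalEquality
open import Relation.Nullary using (yes; no)
open import Relation.Nullary.Decidable using (T?)
open import Data.List.Relation.Binary.Permutation.Setoid.Properties (setoid ℕ)
  using (Unique-resp-↭)

private
  variable
    A B : Set

filterᵇ-comm : (p q : A → Bool) (xs : List A) →
               filterᵇ p (filterᵇ q xs) ≡ filterᵇ q (filterᵇ p xs)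
filterᵇ-comm p q [] = refl
filterᵇ-comm p q (x ∷ xs) with p x in px | q x in qx
... | true  | true  rewrite px | qx = cong (x ∷_) (filterᵇ-comm p q xs)
... | true  | false rewrite qx = filterᵇ-comm p q xs
... | false | true  rewrite px = filterᵇ-comm p q xs
... | false | false = filterᵇ-comm p q xs

filterᵇ-cong : {p q : A → Bool} {xs : List A} →
               All (λ x → p x ≡ q x) xs → filterᵇ p xs ≡ filterᵇ q xs
filterᵇ-cong {xs = []} [] = refl
filterᵇ-cong {p = p} {q} {x ∷ xs} (px≡qx ∷ eqs) with p x | q x | px≡qx
... | true  | true  | _ = cong (x ∷_) (filterᵇ-cong eqs)
... | false | false | _ = filterᵇ-cong eqs

filterᵇ-map : (p : B → Bool) (f : A → B) (xs : List A) →
              filterᵇ p (map f xs) ≡ map f (filterᵇ (p ∘ f) xs)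
filterᵇ-map p f [] = refl
filterᵇ-map p f (x ∷ xs) with p (f x)
... | true  = cong (f x ∷_) (filterᵇ-map p f xs)
... | false = filterᵇ-map p f xs

filterᵇ-const : (b : Bool) (xs : List A) → filterᵇ (λ _ → b) xs ≡ (if b then xs else [])
filterᵇ-const true  []       = refl
filterᵇ-const false []       = refl
filterᵇ-const true  (x ∷ xs) = cong (x ∷_) (filterᵇ-const true xs)
filterᵇ-const false (x ∷ xs) = filterᵇ-const false xs

filterᵇ-concatMap : (p : B → Bool) (f : A → List B) (xs : List A) →
                    filterᵇ p (concatMap f xs) ≡ concatMap (filterᵇ p ∘ f) xs
filterᵇ-concatMap p f [] = refl
filterᵇ-concatMap p f (x ∷ xs) =
  trans (filter-++ (T? ∘ p) (f x) (concatMap f xs))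
        (cong (filterᵇ p (f x) ++_) (filterᵇ-concatMap p f xs))

concatMap-filterᵇ : (g : A → List B) (p : A → Bool) → (∀ x → p x ≡ false → g x ≡ []) →
                    (xs : List A) → concatMap g (filterᵇ p xs) ≡ concatMap g xs
concatMap-filterᵇ g p vanish [] = refl
concatMap-filterᵇ g p vanish (x ∷ xs) with p x in px
... | true  = cong (g x ++_) (concatMap-filterᵇ g p vanish xs)
... | false rewrite vanish x px = concatMap-filterᵇ g p vanish xs

filterᵇ-filterᵇ-map : (p q : A → Bool) (f : A → A) {xs ys : List A} →
                      filterᵇ q xs ≡ map f ys → All (λ y → p (f y) ≡ p y) ys →
                      filterᵇ q (filterᵇ p xs) ≡ map f (filterᵇ p ys)
filterᵇ-filterᵇ-map p q f {xs} {ys} q-part p∘f≡p = begin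
  filterᵇ q (filterᵇ p xs)       ≡⟨ filterᵇ-comm q p xs ⟩
  filterᵇ p (filterᵇ q xs)       ≡⟨ cong (filterᵇ p) q-part ⟩
  filterᵇ p (map f ys)           ≡⟨ filterᵇ-map p f ys ⟩
  map f (filterᵇ (p ∘ f) ys)     ≡⟨ cong (map f) (filterᵇ-cong p∘f≡p) ⟩
  map f (filterᵇ p ys)           ∎
  where open ≡-Reasoning

map-∷-map : (f : A → B) (x : A) (xss : List (List A)) →
            map (f x ∷_) (map (map f) xss) ≡ map (map f) (map (x ∷_) xss)
map-∷-map f x xss = trans (sym (map-∘ xss)) (map-∘ xss)

any-++ : (f : A → Bool) (xs ys : List A) → any f (xs ++ ys) ≡ any f xs ∨ any f ys
any-++ f []       ys = refl
any-++ f (x ∷ xs) ys = trans (cong (f x ∨_) (any-++ f xs ys)) (sym (∨-assoc (f x) _ _))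

any-false : {f : A → Bool} {xs : List A} → All (λ x → f x ≡ false) xs → any f xs ≡ false
any-false []       = refl
any-false (e ∷ es) = cong₂ _∨_ e (any-false es)

∧-true⁻ : ∀ {b c} → b ∧ c ≡ true → b ≡ true × c ≡ true
∧-true⁻ e = ∧-conicalˡ _ _ e , ∧-conicalʳ _ _ e

∧-congʳ-if-true : ∀ {b c c′} → (b ≡ true → c ≡ c′) → b ∧ c ≡ b ∧ c′
∧-congʳ-if-true {false} _ = refl
∧-congʳ-if-true {true}  h = h refl

-- Permutations of [k]

Permutation : ℕ → List ℕ → Set
Permutation k π = π ↭ applyDownFrom suc k

InRange : ℕ → ℕ → Set
InRange k v = 1 ≤ v × v ≤ k

insertEverywhere-↭ : ∀ x ys → All (_↭ x ∷ ys) (insertEverywhere x ys)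
insertEverywhere-↭ x []       = ↭-refl ∷ []
insertEverywhere-↭ x (y ∷ ys) =
  ↭-refl ∷ Allₚ.map⁺ (All.map (λ p → ↭-trans (↭-prep y p) (↭-swap y x ↭-refl))
                              (insertEverywhere-↭ x ys))

perms-↭ : ∀ k → All (Permutation k) (perms k)
perms-↭ zero    = ↭-refl ∷ []
perms-↭ (suc k) = Allₚ.concat⁺ (Allₚ.map⁺ (All.map insertions (perms-↭ k)))
  where
  insertions : ∀ {π} → Permutation k π → All (Permutation (suc k)) (insertEverywhere (suc k) π)
  insertions p = All.map (λ q → ↭-trans q (↭-prep (suc k) p)) (insertEverywhere-↭ (suc k) _)

module _ {k : ℕ} {π : List ℕ} (p : Permutation k π) where

  Permutation-length : length π ≡ k
  Permutation-length = trans (↭-length p) (length-applyDownFrom suc k)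

  Permutation-inRange : All (InRange k) π
  Permutation-inRange =
    All-resp-↭ (↭-sym p) (Allₚ.applyDownFrom⁺₁ suc k (λ i<k → s≤s z≤n , i<k))

  Permutation-unique : Unique π
  Permutation-unique =
    Unique-resp-↭ (↭⇒↭ₛ (↭-sym p))
      (Uniqueₚ.applyDownFrom⁺₁ suc k (λ j<i _ → <⇒≢ j<i ∘ sym ∘ suc-injective))

head≥3 : ∀ {k s} p → Permutation k (s ∷ p ++ 2 ∷ 1 ∷ []) → 3 ≤ s
head≥3 p perm with Permutation-unique perm | Permutation-inRange perm
... | s≢rest AllPairs.∷ _ | (1≤s , _) ∷ _ with Allₚ.++⁻ʳ p s≢rest
... | s≢2 ∷ s≢1 ∷ [] = ≢1⇒≢2⇒3≤ 1≤s s≢1 s≢2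
  where
  ≢1⇒≢2⇒3≤ : ∀ {s} → 1 ≤ s → s ≢ 1 → s ≢ 2 → 3 ≤ s
  ≢1⇒≢2⇒3≤ {suc zero}          _ s≢1 _   = ⊥-elim (s≢1 refl)
  ≢1⇒≢2⇒3≤ {suc (suc zero)}    _ _   s≢2 = ⊥-elim (s≢2 refl)
  ≢1⇒≢2⇒3≤ {suc (suc (suc _))} _ _   _   = s≤s (s≤s (s≤s z≤n))

-- Order isomorphism and pattern containment

sameSide : ℕ → ℕ → ℕ → ℕ → Bool
sameSide x y a b = if a <ᵇ x then b <ᵇ y else not (b <ᵇ y)

-- Defs.orderIso compares through a function local to its where-block;
-- unifying with the unfolding of orderIso gives that function a name.
private
  mutual
    localComparison : ℕ → List ℕ → ℕ → List ℕ → ℕ → ℕ → Bool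
    localComparison x xs y ys a b = _

    orderIso-unfold : ∀ x xs y ys → orderIso (x ∷ xs) (y ∷ ys)
                      ≡ and (zipWith (localComparison x xs y ys) xs ys) ∧ orderIso xs ys
    orderIso-unfold x xs y ys = refl

orderIso-∷ : ∀ x xs y ys →
             orderIso (x ∷ xs) (y ∷ ys) ≡ and (zipWith (sameSide x y) xs ys) ∧ orderIso xs ys
orderIso-∷ x xs y ys =
  trans (orderIso-unfold x xs y ys)
        (cong (λ bs → and bs ∧ orderIso xs ys) (zipWith-cong local≡sameSide xs ys))
  where
  local≡sameSide : ∀ a b → localComparison x xs y ys a b ≡ sameSide x y a b
  local≡sameSide a b with a <ᵇ x
  ... | true  = refl
  ... | false = refl

orderIso-∷⁻ : ∀ {x y} u σ → orderIso (x ∷ u) (y ∷ σ) ≡ true →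
              Pointwise (λ a b → sameSide x y a b ≡ true) u σ × orderIso u σ ≡ true
orderIso-∷⁻ []      []      _ = [] , refl
orderIso-∷⁻ {x} {y} (a ∷ u) (b ∷ σ) iso
  with ∧-true⁻ (trans (sym (orderIso-∷ x (a ∷ u) y (b ∷ σ))) iso)
... | head∧rest , iso-tail
  with ∧-true⁻ head∧rest
... | head , rest =
  head ∷ proj₁ (orderIso-∷⁻ {x} {y} u σ iso′) , iso-tail
  where
  tail : orderIso u σ ≡ true
  tail = proj₂ (∧-true⁻ (trans (sym (orderIso-∷ a u b σ)) iso-tail))
  iso′ : orderIso (x ∷ u) (y ∷ σ) ≡ true
  iso′ = trans (orderIso-∷ x u y σ) (cong₂ _∧_ rest tail)

orderIso-map : {f : ℕ → ℕ} → (∀ a b → (f a <ᵇ f b) ≡ (a <ᵇ b)) →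
               ∀ u σ → orderIso (map f u) σ ≡ orderIso u σ
orderIso-map f-mono []      []      = refl
orderIso-map f-mono []      (_ ∷ _) = refl
orderIso-map f-mono (_ ∷ _) []      = refl
orderIso-map {f} f-mono (x ∷ xs) (y ∷ ys) = begin
  orderIso (f x ∷ map f xs) (y ∷ ys)
    ≡⟨ orderIso-∷ (f x) (map f xs) y ys ⟩
  and (zipWith (sameSide (f x) y) (map f xs) ys) ∧ orderIso (map f xs) ys
    ≡⟨ cong₂ (λ bs b → and bs ∧ b) (comparisons xs ys) (orderIso-map f-mono xs ys) ⟩
  and (zipWith (sameSide x y) xs ys) ∧ orderIso xs ys
    ≡⟨ orderIso-∷ x xs y ys ⟨
  orderIso (x ∷ xs) (y ∷ ys) ∎
  where
  open ≡-Reasoning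
  comparisons : ∀ as bs → zipWith (sameSide (f x) y) (map f as) bs ≡ zipWith (sameSide x y) as bs
  comparisons []       _        = refl
  comparisons (_ ∷ _)  []       = refl
  comparisons (a ∷ as) (b ∷ bs) =
    cong₂ _∷_ (cong (λ c → if c then b <ᵇ y else not (b <ᵇ y)) (f-mono a x)) (comparisons as bs)

-- Likewise for the append function local to Defs.subseqs; the with-abstractions make its
-- arguments variables so that unification can solve for it.
private
  mutual
    localAppend : ℕ → ℕ → List ℕ → List (List ℕ) → List (List ℕ) → List (List ℕ)
    localAppend k x xs withX withoutX = _

    subseqs-unfold : ∀ k x xs → subseqs (suc k) (x ∷ xs)
                     ≡ localAppend k x xs (map (x ∷_) (subseqs k xs)) (subseqs (suc k) xs)
    subseqs-unfold k x xs with subseqs (suc k) xs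
    ... | withoutX with map (List._∷_ x) (subseqs k xs)
    ...   | withX = refl

localAppend≡++ : ∀ k x xs withX withoutX → localAppend k x xs withX withoutX ≡ withX ++ withoutX
localAppend≡++ k x xs []      withoutX = refl
localAppend≡++ k x xs (u ∷ us) withoutX = cong (u ∷_) (localAppend≡++ k x xs us withoutX)

subseqs-∷ : ∀ k x xs → subseqs (suc k) (x ∷ xs) ≡ map (x ∷_) (subseqs k xs) ++ subseqs (suc k) xs
subseqs-∷ k x xs =
  trans (subseqs-unfold k x xs)
        (localAppend≡++ k x xs (map (x ∷_) (subseqs k xs)) (subseqs (suc k) xs))

subseqs-All : {P : ℕ → Set} → ∀ k {w} → All P w → All (All P) (subseqs k w)
subseqs-All zero    _                      = [] ∷ []
subseqs-All (suc k) []                     = []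
subseqs-All (suc k) {x ∷ w} (px ∷ pw) rewrite subseqs-∷ k x w =
  Allₚ.++⁺ (Allₚ.map⁺ (All.map (px ∷_) (subseqs-All k pw))) (subseqs-All (suc k) pw)

subseqs-map : (f : ℕ → ℕ) → ∀ k w → subseqs k (map f w) ≡ map (map f) (subseqs k w)
subseqs-map f zero    w       = refl
subseqs-map f (suc k) []      = refl
subseqs-map f (suc k) (x ∷ w) = begin
  subseqs (suc k) (f x ∷ map f w)
    ≡⟨ subseqs-∷ k (f x) (map f w) ⟩
  map (f x ∷_) (subseqs k (map f w)) ++ subseqs (suc k) (map f w)
    ≡⟨ cong₂ (λ s t → map (f x ∷_) s ++ t) (subseqs-map f k w) (subseqs-map f (suc k) w) ⟩
  map (f x ∷_) (map (map f) (subseqs k w)) ++ map (map f) (subseqs (suc k) w)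
    ≡⟨ cong (_++ _) (map-∷-map f x (subseqs k w)) ⟩
  map (map f) (map (x ∷_) (subseqs k w)) ++ map (map f) (subseqs (suc k) w)
    ≡⟨ map-++ (map f) (map (x ∷_) (subseqs k w)) (subseqs (suc k) w) ⟨
  map (map f) (map (x ∷_) (subseqs k w) ++ subseqs (suc k) w)
    ≡⟨ cong (map (map f)) (subseqs-∷ k x w) ⟨
  map (map f) (subseqs (suc k) (x ∷ w)) ∎
  where open ≡-Reasoning

contains-map : {f : ℕ → ℕ} → (∀ a b → (f a <ᵇ f b) ≡ (a <ᵇ b)) →
               ∀ σ w → contains σ (map f w) ≡ contains σ w
contains-map {f} f-mono σ w = cong or (begin
  map occurs (subseqs (length σ) (map f w))
    ≡⟨ cong (map occurs) (subseqs-map f (length σ) w) ⟩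
  map occurs (map (map f) (subseqs (length σ) w))
    ≡⟨ map-∘ (subseqs (length σ) w) ⟨
  map (occurs ∘ map f) (subseqs (length σ) w)
    ≡⟨ map-cong (λ u → orderIso-map f-mono u σ) (subseqs (length σ) w) ⟩
  map occurs (subseqs (length σ) w) ∎)
  where
  open ≡-Reasoning
  occurs : List ℕ → Bool
  occurs u = orderIso u σ

contains-∷ : {P : ℕ → Set} {x s : ℕ} {σ : List ℕ} {w : List ℕ} →
             (∀ u → All P u → orderIso (x ∷ u) (s ∷ σ) ≡ false) → All P w →
             contains (s ∷ σ) (x ∷ w) ≡ contains (s ∷ σ) w
contains-∷ {x = x} {s} {σ} {w} not-from-x pw = begin
  any occurs (subseqs (suc (length σ)) (x ∷ w))
    ≡⟨ cong (any occurs) (subseqs-∷ (length σ) x w) ⟩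
  any occurs (map (x ∷_) (subseqs (length σ) w) ++ subseqs (suc (length σ)) w)
    ≡⟨ any-++ occurs (map (x ∷_) (subseqs (length σ) w)) _ ⟩
  any occurs (map (x ∷_) (subseqs (length σ) w)) ∨ contains (s ∷ σ) w
    ≡⟨ cong (_∨ _) (any-false (Allₚ.map⁺ (All.map (not-from-x _) (subseqs-All (length σ) pw)))) ⟩
  contains (s ∷ σ) w ∎
  where
  open ≡-Reasoning
  occurs : List ℕ → Bool
  occurs u = orderIso u (s ∷ σ)

≤⇒≮ᵇ : ∀ {x a} → x ≤ a → (a <ᵇ x) ≡ false
≤⇒≮ᵇ z≤n       = refl
≤⇒≮ᵇ (s≤s x≤a) = ≤⇒≮ᵇ x≤a

orderIso-min∷-descent : ∀ {x s b σ} u → (b <ᵇ s) ≡ true → All (x ≤_) u →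
                        orderIso (x ∷ u) (s ∷ b ∷ σ) ≡ false
orderIso-min∷-descent []      b<s _           = refl
orderIso-min∷-descent (a ∷ u) b<s (x≤a ∷ _) rewrite ≤⇒≮ᵇ x≤a | b<s = refl

-- The entries matched with 2 and 1 lie below the leading 2, hence both are 1: no descent.
private
  no-21-below-2 : ∀ {s} p u → 3 ≤ s → All (1 ≤_) u →
                  Pointwise (λ a b → sameSide 2 s a b ≡ true) u (p ++ 2 ∷ 1 ∷ []) →
                  orderIso u (p ++ 2 ∷ 1 ∷ []) ≡ true → ⊥
  no-21-below-2 [] (suc zero ∷ suc zero ∷ []) (s≤s (s≤s (s≤s _))) _ _ ()
  no-21-below-2 [] (suc zero ∷ zero ∷ []) _ (_ ∷ () ∷ []) _ _
  no-21-below-2 [] (suc (suc _) ∷ _ ∷ []) (s≤s (s≤s (s≤s _))) _ (() ∷ _) _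
  no-21-below-2 [] (suc zero ∷ suc (suc _) ∷ []) (s≤s (s≤s (s≤s _))) _ (_ ∷ () ∷ []) _
  no-21-below-2 [] (_ ∷ _ ∷ _ ∷ _) _ _ (_ ∷ _ ∷ ()) _
  no-21-below-2 (c ∷ p) (a ∷ u) s≥3 (_ ∷ u≥1) (_ ∷ below) iso =
    no-21-below-2 p u s≥3 u≥1 below (proj₂ (orderIso-∷⁻ {a} {c} u (p ++ 2 ∷ 1 ∷ []) iso))

orderIso-2∷-ending21 : ∀ {s} p u → 3 ≤ s → All (1 ≤_) u →
                       orderIso (2 ∷ u) (s ∷ p ++ 2 ∷ 1 ∷ []) ≡ false
orderIso-2∷-ending21 {s} p u s≥3 u≥1 = ¬-not λ iso →
  let below , iso-tail = orderIso-∷⁻ {2} {s} u (p ++ 2 ∷ 1 ∷ []) iso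
  in no-21-below-2 p u s≥3 u≥1 below iso-tail

skip2 : ℕ → ℕ
skip2 zero          = zero
skip2 (suc zero)    = suc zero
skip2 (suc (suc v)) = suc (suc (suc v))

cons2 : List ℕ → List ℕ
cons2 π = 2 ∷ map skip2 π

skip2-<ᵇ : ∀ a b → (skip2 a <ᵇ skip2 b) ≡ (a <ᵇ b)
skip2-<ᵇ zero          zero          = refl
skip2-<ᵇ zero          (suc zero)    = refl
skip2-<ᵇ zero          (suc (suc b)) = refl
skip2-<ᵇ (suc zero)    zero          = refl
skip2-<ᵇ (suc zero)    (suc zero)    = refl
skip2-<ᵇ (suc zero)    (suc (suc b)) = refl
skip2-<ᵇ (suc (suc a)) zero          = refl
skip2-<ᵇ (suc (suc a)) (suc zero)    = refl
skip2-<ᵇ (suc (suc a)) (suc (suc b)) = refl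

skip2-≡ᵇ : ∀ a b → (skip2 a ≡ᵇ skip2 b) ≡ (a ≡ᵇ b)
skip2-≡ᵇ zero          zero          = refl
skip2-≡ᵇ zero          (suc zero)    = refl
skip2-≡ᵇ zero          (suc (suc b)) = refl
skip2-≡ᵇ (suc zero)    zero          = refl
skip2-≡ᵇ (suc zero)    (suc zero)    = refl
skip2-≡ᵇ (suc zero)    (suc (suc b)) = refl
skip2-≡ᵇ (suc (suc a)) zero          = refl
skip2-≡ᵇ (suc (suc a)) (suc zero)    = refl
skip2-≡ᵇ (suc (suc a)) (suc (suc b)) = refl

1≤skip2 : ∀ {v} → 1 ≤ v → 1 ≤ skip2 v
1≤skip2 {suc zero}    _ = s≤s z≤n
1≤skip2 {suc (suc v)} _ = s≤s z≤n

2≤skip2 : ∀ {v} → 2 ≤ v → 2 ≤ skip2 v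
2≤skip2 {suc zero}    (s≤s ())
2≤skip2 {suc (suc v)} _ = s≤s (s≤s z≤n)

avoids-cons2 : ∀ {s} p π → 3 ≤ s → All (1 ≤_) π →
               avoids (s ∷ p ++ 2 ∷ 1 ∷ []) (cons2 π) ≡ avoids (s ∷ p ++ 2 ∷ 1 ∷ []) π
avoids-cons2 {s} p π s≥3 π≥1 = cong not (trans
  (contains-∷ {σ = p ++ 2 ∷ 1 ∷ []} (λ u → orderIso-2∷-ending21 p u s≥3)
              (Allₚ.map⁺ (All.map 1≤skip2 π≥1)))
  (contains-map {skip2} skip2-<ᵇ (s ∷ p ++ 2 ∷ 1 ∷ []) π))

-- Permutations of [n] beginning with 2

startsWith2 : List ℕ → Bool
startsWith2 []      = false
startsWith2 (x ∷ _) = x ≡ᵇ 2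

c₂≡2-startsWith2 : ∀ {m} π → length π ≡ suc (suc m) → c₂≡2 π ≡ startsWith2 π
c₂≡2-startsWith2 (_ ∷ _ ∷ _) _ = refl

insertEverywhere-map : (f : ℕ → ℕ) → ∀ x ys →
                       insertEverywhere (f x) (map f ys) ≡ map (map f) (insertEverywhere x ys)
insertEverywhere-map f x []       = refl
insertEverywhere-map f x (y ∷ ys) = cong ((f x ∷ f y ∷ map f ys) ∷_)
  (trans (cong (map (f y ∷_)) (insertEverywhere-map f x ys))
         (map-∷-map f y (insertEverywhere x ys)))

insertEverywhere-startsWith2 : ∀ m x ys →
  filterᵇ startsWith2 (insertEverywhere (3 + m) (x ∷ ys))
  ≡ map (x ∷_) (if x ≡ᵇ 2 then insertEverywhere (3 + m) ys else [])
insertEverywhere-startsWith2 m x ys =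
  trans (filterᵇ-map startsWith2 (x ∷_) (insertEverywhere (3 + m) ys))
        (cong (map (x ∷_)) (filterᵇ-const (x ≡ᵇ 2) (insertEverywhere (3 + m) ys)))

perms-startsWith2 : ∀ m → filterᵇ startsWith2 (perms (2 + m)) ≡ map cons2 (perms (1 + m))
perms-startsWith2 zero    = refl
perms-startsWith2 (suc m) = begin
  filterᵇ startsWith2 (concatMap (insertEverywhere (3 + m)) (perms (2 + m)))
    ≡⟨ filterᵇ-concatMap startsWith2 (insertEverywhere (3 + m)) (perms (2 + m)) ⟩
  concatMap insertions₂ (perms (2 + m))
    ≡⟨ concatMap-filterᵇ insertions₂ startsWith2 vanish (perms (2 + m)) ⟨
  concatMap insertions₂ (filterᵇ startsWith2 (perms (2 + m)))
    ≡⟨ cong (concatMap insertions₂) (perms-startsWith2 m) ⟩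
  concatMap insertions₂ (map cons2 (perms (1 + m)))
    ≡⟨ concatMap-map insertions₂ cons2 (perms (1 + m)) ⟩
  concatMap (insertions₂ ∘ cons2) (perms (1 + m))
    ≡⟨ concatMap-cong insertions₂-cons2 (perms (1 + m)) ⟩
  concatMap (map cons2 ∘ insertEverywhere (2 + m)) (perms (1 + m))
    ≡⟨ map-concatMap cons2 (insertEverywhere (2 + m)) (perms (1 + m)) ⟨
  map cons2 (perms (2 + m)) ∎
  where
  open ≡-Reasoning
  insertions₂ : List ℕ → List (List ℕ)
  insertions₂ π = filterᵇ startsWith2 (insertEverywhere (3 + m) π)

  vanish : ∀ π → startsWith2 π ≡ false → insertions₂ π ≡ []
  vanish []      _   = refl
  vanish (x ∷ π) x≢2 =
    trans (insertEverywhere-startsWith2 m x π)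
          (cong (λ b → map (x ∷_) (if b then insertEverywhere (3 + m) π else [])) x≢2)

  insertions₂-cons2 : ∀ π → insertions₂ (cons2 π) ≡ map cons2 (insertEverywhere (2 + m) π)
  insertions₂-cons2 π = begin
    insertions₂ (cons2 π)
      ≡⟨ insertEverywhere-startsWith2 m 2 (map skip2 π) ⟩
    map (2 ∷_) (insertEverywhere (skip2 (2 + m)) (map skip2 π))
      ≡⟨ cong (map (2 ∷_)) (insertEverywhere-map skip2 (2 + m) π) ⟩
    map (2 ∷_) (map (map skip2) (insertEverywhere (2 + m) π))
      ≡⟨ map-∘ (insertEverywhere (2 + m) π) ⟨
    map cons2 (insertEverywhere (2 + m) π) ∎

filterᵇ-c₂≡2-perms : ∀ m → filterᵇ c₂≡2 (perms (2 + m)) ≡ map cons2 (perms (1 + m))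
filterᵇ-c₂≡2-perms m =
  trans (filterᵇ-cong (All.map c₂≡2≡startsWith2 (perms-↭ (2 + m)))) (perms-startsWith2 m)
  where
  c₂≡2≡startsWith2 : ∀ {π} → Permutation (2 + m) π → c₂≡2 π ≡ startsWith2 π
  c₂≡2≡startsWith2 {π} p = c₂≡2-startsWith2 π (Permutation-length p)

-- Cycle forms

ρ₂₁₃ : List ℕ
ρ₂₁₃ = 2 ∷ 1 ∷ 3 ∷ []

-- inA σs ρ₂₁₃ π unfolds to cycleTest (all (λ σ → avoids σ π) σs) (cycleForm π).
cycleTest : Bool → List ℕ → Bool
cycleTest A c = distinct c ∧ (A ∧ avoids ρ₂₁₃ c)

_∉ᵇ_ : ℕ → List ℕ → Bool
x ∉ᵇ ys = all (λ y → not (x ≡ᵇ y)) ys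

1∈⇒1∉ᵇ≡false : ∀ {ys} → 1 ∈ ys → 1 ∉ᵇ ys ≡ false
1∈⇒1∉ᵇ≡false         (here refl)  = refl
1∈⇒1∉ᵇ≡false {y ∷ _} (there 1∈ys) =
  trans (cong (not (1 ≡ᵇ y) ∧_) (1∈⇒1∉ᵇ≡false 1∈ys)) (∧-zeroʳ _)

∉ᵇ-map : {f : ℕ → ℕ} → (∀ a b → (f a ≡ᵇ f b) ≡ (a ≡ᵇ b)) →
         ∀ x ys → f x ∉ᵇ map f ys ≡ x ∉ᵇ ys
∉ᵇ-map f-inj x ys = cong and (trans (sym (map-∘ ys)) (map-cong (λ y → cong not (f-inj x y)) ys))

distinct-map : {f : ℕ → ℕ} → (∀ a b → (f a ≡ᵇ f b) ≡ (a ≡ᵇ b)) →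
               ∀ xs → distinct (map f xs) ≡ distinct xs
distinct-map f-inj []       = refl
distinct-map f-inj (x ∷ xs) = cong₂ _∧_ (∉ᵇ-map f-inj x xs) (distinct-map f-inj xs)

2∉ᵇskip2 : ∀ ys → 2 ∉ᵇ map skip2 ys ≡ true
2∉ᵇskip2 []                 = refl
2∉ᵇskip2 (zero ∷ ys)        = 2∉ᵇskip2 ys
2∉ᵇskip2 (suc zero ∷ ys)    = 2∉ᵇskip2 ys
2∉ᵇskip2 (suc (suc _) ∷ ys) = 2∉ᵇskip2 ys

1∉ᵇ⇒2≤ : ∀ {ys} → All (1 ≤_) ys → 1 ∉ᵇ ys ≡ true → All (2 ≤_) ys
1∉ᵇ⇒2≤ {[]}               []       _ = []
1∉ᵇ⇒2≤ {suc (suc _) ∷ ys} (_ ∷ ys≥1) e = s≤s (s≤s z≤n) ∷ 1∉ᵇ⇒2≤ ys≥1 e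

-- apply returns 0 outside the index range, hence the hypothesis f 0 ≡ 0.
apply-map : (f : ℕ → ℕ) → f 0 ≡ 0 → ∀ xs i → apply (map f xs) i ≡ f (apply xs i)
apply-map f f0 []       i             = sym f0
apply-map f f0 (x ∷ xs) zero          = sym f0
apply-map f f0 (x ∷ xs) (suc zero)    = refl
apply-map f f0 (x ∷ xs) (suc (suc i)) = apply-map f f0 xs (suc i)

apply-All : {Q : ℕ → Set} → ∀ {xs i} → All Q xs → 1 ≤ i → i ≤ length xs → Q (apply xs i)
apply-All {i = suc zero}    (q ∷ _)  _ _         = q
apply-All {i = suc (suc i)} (_ ∷ qs) _ (s≤s i≤n) = apply-All qs (s≤s z≤n) i≤n

orbitSeq-inRange : ∀ {m π} → length π ≡ m → All (InRange m) π →
                   ∀ j {x} → InRange m x → All (InRange m) (orbitSeq π j x)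
orbitSeq-inRange refl π-range zero    _           = []
orbitSeq-inRange refl π-range (suc j) x@(1≤x , x≤m) =
  x ∷ orbitSeq-inRange refl π-range j (apply-All π-range 1≤x x≤m)

apply-cons2 : ∀ π x → x ≢ 1 → apply (cons2 π) (skip2 x) ≡ skip2 (apply π x)
apply-cons2 []      zero          _   = refl
apply-cons2 (_ ∷ _) zero          _   = refl
apply-cons2 π       (suc zero)    x≢1 = ⊥-elim (x≢1 refl)
apply-cons2 π       (suc (suc x)) _   = apply-map skip2 refl π (suc (suc x))

orbitSeq-cons2 : ∀ π j x →
  (1 ∈ orbitSeq π j x × 1 ∈ orbitSeq (cons2 π) j (skip2 x))
  ⊎ orbitSeq (cons2 π) j (skip2 x) ≡ map skip2 (orbitSeq π j x)
orbitSeq-cons2 π zero    x = inj₂ refl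
orbitSeq-cons2 π (suc j) x with x ≟ 1
... | yes refl = inj₁ (here refl , here refl)
... | no x≢1 rewrite apply-cons2 π x x≢1 with orbitSeq-cons2 π j (apply π x)
...   | inj₁ (o , o′) = inj₁ (there o , there o′)
...   | inj₂ e        = inj₂ (cong (skip2 x ∷_) e)

distinct-1∷2∷skip2 : ∀ O → distinct (1 ∷ 2 ∷ map skip2 O) ≡ distinct (1 ∷ O)
distinct-1∷2∷skip2 O =
  cong₂ _∧_ (∉ᵇ-map skip2-≡ᵇ 1 O)
            (trans (cong (_∧ distinct (map skip2 O)) (2∉ᵇskip2 O)) (distinct-map skip2-≡ᵇ O))

avoids-ρ₂₁₃-1∷2∷skip2 : ∀ O → All (2 ≤_) O → avoids ρ₂₁₃ (1 ∷ 2 ∷ map skip2 O) ≡ avoids ρ₂₁₃ (1 ∷ O)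
avoids-ρ₂₁₃-1∷2∷skip2 O O≥2 = cong not (begin
  contains ρ₂₁₃ (1 ∷ 2 ∷ map skip2 O)
    ≡⟨ contains-∷ (cannotStart 1) (s≤s z≤n ∷ All.map weaken skip2O≥2) ⟩
  contains ρ₂₁₃ (2 ∷ map skip2 O)
    ≡⟨ contains-∷ (cannotStart 2) skip2O≥2 ⟩
  contains ρ₂₁₃ (map skip2 O)
    ≡⟨ contains-map {skip2} skip2-<ᵇ ρ₂₁₃ O ⟩
  contains ρ₂₁₃ O
    ≡⟨ contains-∷ (cannotStart 1) (All.map weaken O≥2) ⟨
  contains ρ₂₁₃ (1 ∷ O) ∎)
  where
  open ≡-Reasoning
  cannotStart : ∀ x u → All (x ≤_) u → orderIso (x ∷ u) ρ₂₁₃ ≡ false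
  cannotStart x u = orderIso-min∷-descent {x} {2} {1} {3 ∷ []} u refl
  weaken : ∀ {v} → 2 ≤ v → 1 ≤ v
  weaken = ≤-trans (s≤s z≤n)
  skip2O≥2 : All (2 ≤_) (map skip2 O)
  skip2O≥2 = Allₚ.map⁺ (All.map 2≤skip2 O≥2)

cycleTest-1∷2∷skip2 : ∀ A O → All (1 ≤_) O → cycleTest A (1 ∷ 2 ∷ map skip2 O) ≡ cycleTest A (1 ∷ O)
cycleTest-1∷2∷skip2 A O O≥1 = begin
  distinct (1 ∷ 2 ∷ map skip2 O) ∧ (A ∧ avoids ρ₂₁₃ (1 ∷ 2 ∷ map skip2 O))
    ≡⟨ cong (_∧ (A ∧ avoids ρ₂₁₃ (1 ∷ 2 ∷ map skip2 O))) (distinct-1∷2∷skip2 O) ⟩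
  distinct (1 ∷ O) ∧ (A ∧ avoids ρ₂₁₃ (1 ∷ 2 ∷ map skip2 O))
    ≡⟨ ∧-congʳ-if-true (λ distinct-1∷O →
         cong (A ∧_) (avoids-ρ₂₁₃-1∷2∷skip2 O (1∉ᵇ⇒2≤ O≥1 (proj₁ (∧-true⁻ distinct-1∷O))))) ⟩
  distinct (1 ∷ O) ∧ (A ∧ avoids ρ₂₁₃ (1 ∷ O)) ∎
  where open ≡-Reasoning

cycleForm-∷ : ∀ {l} π → length π ≡ suc l → cycleForm π ≡ 1 ∷ orbitSeq π l (apply π 1)
cycleForm-∷ π e rewrite e = refl

cycleForm-cons2 : ∀ {l} π → length π ≡ suc l →
                  cycleForm (cons2 π) ≡ 1 ∷ 2 ∷ orbitSeq (cons2 π) l (skip2 (apply π 1))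
cycleForm-cons2 π e rewrite length-map skip2 π | e | apply-map skip2 refl π 1 = refl

cycleTest-1∈ : ∀ A {c} → 1 ∈ c → cycleTest A (1 ∷ c) ≡ false
cycleTest-1∈ A {c} 1∈c =
  cong (λ b → (b ∧ distinct c) ∧ (A ∧ avoids ρ₂₁₃ (1 ∷ c))) (1∈⇒1∉ᵇ≡false 1∈c)

cycleTest-orbitSeq : ∀ A π j x → All (1 ≤_) (orbitSeq π j x) →
  cycleTest A (1 ∷ 2 ∷ orbitSeq (cons2 π) j (skip2 x)) ≡ cycleTest A (1 ∷ orbitSeq π j x)
cycleTest-orbitSeq A π j x O≥1 with orbitSeq-cons2 π j x
... | inj₁ (1∈O , 1∈O′) = trans (cycleTest-1∈ A (there {x = 2} 1∈O′)) (sym (cycleTest-1∈ A 1∈O))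
... | inj₂ O′≡skip2O    =
  trans (cong (λ O′ → cycleTest A (1 ∷ 2 ∷ O′)) O′≡skip2O) (cycleTest-1∷2∷skip2 A _ O≥1)

cycleTest-cons2 : ∀ A {l π} → Permutation (suc l) π →
                  cycleTest A (cycleForm (cons2 π)) ≡ cycleTest A (cycleForm π)
cycleTest-cons2 A {l} {π} p = begin
  cycleTest A (cycleForm (cons2 π))
    ≡⟨ cong (cycleTest A) (cycleForm-cons2 π length≡) ⟩
  cycleTest A (1 ∷ 2 ∷ orbitSeq (cons2 π) l (skip2 (apply π 1)))
    ≡⟨ cycleTest-orbitSeq A π l (apply π 1) (All.map proj₁ orbit-range) ⟩
  cycleTest A (1 ∷ orbitSeq π l (apply π 1))
    ≡⟨ cong (cycleTest A) (cycleForm-∷ π length≡) ⟨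
  cycleTest A (cycleForm π) ∎
  where
  open ≡-Reasoning
  length≡ : length π ≡ suc l
  length≡ = Permutation-length p
  π-range : All (InRange (suc l)) π
  π-range = Permutation-inRange p
  orbit-range : All (InRange (suc l)) (orbitSeq π l (apply π 1))
  orbit-range = orbitSeq-inRange length≡ π-range l
                  (apply-All π-range (s≤s z≤n) (subst (1 ≤_) (sym length≡) (s≤s z≤n)))

inA-cons2 : ∀ σs {l π} → Permutation (suc l) π →
            All (λ σ → avoids σ (cons2 π) ≡ avoids σ π) σs →
            inA σs ρ₂₁₃ (cons2 π) ≡ inA σs ρ₂₁₃ π
inA-cons2 σs {π = π} p avoidance =
  trans (cong (λ A → cycleTest A (cycleForm (cons2 π))) (cong and (map-cong-local avoidance)))
        (cycleTest-cons2 _ p)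

lemma3p3 : (n k : ℕ) → 5 ≤ n → 4 ≤ k →
    (τ : List ℕ) → τ ∈ perms k →
    (Σ (List ℕ) λ τ' → τ ≡ τ' ++ (2 ∷ 1 ∷ [])) →
    length (𝒜₂² n (τ ∷ (4 ∷ 3 ∷ 2 ∷ 1 ∷ []) ∷ []) (2 ∷ 1 ∷ 3 ∷ []))
    ≡ a (n ∸ 1) (τ ∷ (4 ∷ 3 ∷ 2 ∷ 1 ∷ []) ∷ []) (2 ∷ 1 ∷ 3 ∷ [])
lemma3p3 n k _ k≥4 τ τ∈ ([] , refl)
  with Permutation-length (All.lookup (perms-↭ k) τ∈) | k≥4
... | refl | s≤s (s≤s ())
lemma3p3 (suc (suc m)) k (s≤s (s≤s _)) _ τ τ∈ (s ∷ p , refl) = begin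
  length (filterᵇ c₂≡2 (filterᵇ (inA σs ρ₂₁₃) (perms (2 + m))))
    ≡⟨ cong length (filterᵇ-filterᵇ-map (inA σs ρ₂₁₃) c₂≡2 cons2 {perms (2 + m)}
                      (filterᵇ-c₂≡2-perms m) (All.map invariant (perms-↭ (1 + m)))) ⟩
  length (map cons2 (𝒜 (1 + m) σs ρ₂₁₃))
    ≡⟨ length-map cons2 (𝒜 (1 + m) σs ρ₂₁₃) ⟩
  a (1 + m) σs ρ₂₁₃ ∎
  where
  open ≡-Reasoning
  σs : List (List ℕ)
  σs = (s ∷ p ++ 2 ∷ 1 ∷ []) ∷ (4 ∷ 3 ∷ 2 ∷ 1 ∷ []) ∷ []
  invariant : ∀ {π} → Permutation (1 + m) π → inA σs ρ₂₁₃ (cons2 π) ≡ inA σs ρ₂₁₃ π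
  invariant {π} perm =
    inA-cons2 σs perm (avoids-cons2 p π (head≥3 p (All.lookup (perms-↭ k) τ∈)) π≥1
                      ∷ avoids-cons2 (3 ∷ []) π (s≤s (s≤s (s≤s z≤n))) π≥1 ∷ [])
    where
    π≥1 : All (1 ≤_) π
    π≥1 = All.map proj₁ (Permutation-inRange perm)
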